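{- Let $L$ be a model and let $f:L\to L$ be $\alpha$-monotone for every $\alpha<\kappa$. Let $X\subseteq L$ be a set of post-fixed points of $f$ with respect to $\leq$ (i.e., $x\leq f(x)$ for all $x\in X$). Then there is a unique $y\in L$ such that $x\sqsubseteq y$ for all $x\in X$, $f(y)=y$, and for all $z\in L$, if $x\sqsubseteq z$ for all $x\in X$ and $f(z)\sqsubseteq z$, then $y\sqsubseteq z$.
   Context: Fix a limit ordinal $\kappa$. A stratified complete lattice is $(L,\leq,(\sqsubseteq_\alpha)_{\alpha<\kappa})$ with $(L,\leq)$ a complete lattice and each $\sqsubseteq_\alpha$ a preorder; $x=_\alpha y$ means $x\sqsubseteq_\alpha y$ and $y\sqsubseteq_\alpha x$. A model satisfies: (A1) for $\alpha<\beta<\kappa$, $x\sqsubseteq_\beta y$ implies $x=_\alpha y$; (A2) if $x=_\alpha y$ for all $\alpha$ then $x=y$; (A3) for all $x,\alpha$ there is $y$ with $x=_\alpha y$ such that $x\sqsubseteq_\alpha z$ implies $y\leq z$ (unique, denoted $x|_\alpha$); (A4) for nonempty $I$ and $x_i=_\alpha y$ ($i\in I$), $\bigvee_i x_i=_\alpha y$; (A5) $x\leq y$ implies $x|_\alpha\leq y|_\alpha$; (A6) if $x\leq y$ and $x=_\beta y$ for all $\beta<\alpha$ then $x\sqsubseteq_\alpha y$. On a model, define $x\sqsubseteq y$ iff $x=y$ or there is $\alpha<\kappa$ with $x\sqsubseteq_\alpha y$ and not $y\sqsubseteq_\alpha x$ (this is a partial order). A function $f:L\to L$ is $\alpha$-monotone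 if $x\sqsubseteq_\alpha y$ implies $f(x)\sqsubseteq_\alpha f(y)$. -}

module Defs where

open import Level using (Level; _⊔_) renaming (suc to lsuc)
open import Data.Product using (Σ; ∃; _×_; _,_; proj₁; proj₂)
open import Data.Sum using (_⊎_)
open import Relation.Nullary using (¬_)
open import Relation.Binary.PropositionalEquality using (_≡_)
open import Relation.Binary.Core using (Rel)
open import Relation.Binary.Structures using (IsPartialOrder; IsPreorder; IsStrictTotalOrder)
open import Induction.WellFounded using (WellFounded)
open import Relation.Unary using (Pred)

-- A limit ordinal κ is represented by the set of ordinals below κ:
-- an inhabited, well-founded strict total order without a greatest element.
record LimitOrdinal (c : Level) : Set (lsuc c) where
  field
    Ord        : Set c
    _<_        : Rel Ord c
    isSTO      : IsStrictTotalOrder _≡_ _<_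
    wf         : WellFounded _<_
    inhabited  : Ord
    noMax      : ∀ α → ∃ λ β → α < β

record Model (c : Level) (κ : LimitOrdinal c) : Set (lsuc c) where
  open LimitOrdinal κ public
  field
    L          : Set c
    _≤_        : Rel L c
    isPO       : IsPartialOrder _≡_ _≤_
    -- completeness: every family (equivalently, subset) has a least upper bound
    ⋁          : {I : Set c} → (I → L) → L
    ⋁-ub       : {I : Set c} (x : I → L) (i : I) → x i ≤ ⋁ x
    ⋁-least    : {I : Set c} (x : I → L) (z : L) → (∀ i → x i ≤ z) → ⋁ x ≤ z
    _⊑[_]_     : L → Ord → L → Set c
    ⊑-preorder : ∀ α → IsPreorder _≡_ (λ x y → x ⊑[ α ] y)

  _=[_]_ : L → Ord → L → Set c
  x =[ α ] y = (x ⊑[ α ] y) × (y ⊑[ α ] x)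

  field
    A1 : ∀ {α β x y} → α < β → x ⊑[ β ] y → x =[ α ] y
    A2 : ∀ {x y} → (∀ α → x =[ α ] y) → x ≡ y
    -- (A3): existence of x|α; the element is unique by antisymmetry of ≤
    A3 : ∀ x α → Σ L λ y → (x =[ α ] y) × (∀ z → x ⊑[ α ] z → y ≤ z)

  _∣_ : L → Ord → L
  x ∣ α = proj₁ (A3 x α)

  field
    A4 : ∀ {I : Set c} → I → (x : I → L) (y : L) (α : Ord) →
         (∀ i → x i =[ α ] y) → ⋁ x =[ α ] y
    A5 : ∀ {x y} α → x ≤ y → (x ∣ α) ≤ (y ∣ α)
    A6 : ∀ {x y} α → x ≤ y → (∀ β → β < α → x =[ β ] y) → x ⊑[ α ] y

  _⊑_ : L → L → Set c
  x ⊑ y = (x ≡ y) ⊎ (Σ Ord λ α → (x ⊑[ α ] y) × ¬ (y ⊑[ α ] x))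

  _-Monotone_ : Ord → (L → L) → Set c
  α -Monotone f = ∀ {x y} → x ⊑[ α ] y → f x ⊑[ α ] f y

module Submission where

-- Proof idea (Knaster–Tarski built level by level).  The least fixed point y
-- above X is constructed by transfinite recursion over κ: the α-th stage Z α
-- lives in the "slice" of elements agreeing below α with the glued earlier
-- stages, and is the least fixed point there of the operator
--   w ↦ f(w)|α ∨ ⋁ { x|α : x ∈ X in the slice }.
-- The stages are coherent (Z β =β Z α for β < α) and each is an α-fixed point
-- of f, so gluing all of them yields y with f y = y by (A2).

open import Defs
open import Level using (Level)
open import Data.Product using (_×_; ∃!; Σ; _,_; proj₁; proj₂)
open import Data.Sum using (_⊎_; inj₁; inj₂)
open import Data.Unit.Polymorphic using (⊤; tt)
open import Data.Empty using (⊥-elim)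
open import Relation.Nullary using (¬_; yes; no)
open import Relation.Binary.PropositionalEquality using (_≡_; refl; sym; cong; subst)
open import Relation.Unary using (Pred)
open import Relation.Binary.Definitions using (tri<; tri≈; tri>)
open import Relation.Binary.Structures using (IsPartialOrder; IsPreorder; IsStrictTotalOrder)
open import Induction.WellFounded using (WfRec; module All; module FixPoint)
open import Axiom.ExcludedMiddle using (ExcludedMiddle)
open import Axiom.DoubleNegationElimination using (em⇒dne)

-- Classically, a property of ordinals that fails somewhere fails at a least
-- ordinal.  This is how the first level of disagreement of two elements is found.
minimal-counterexample : {c : Level} (κ : LimitOrdinal c) → ExcludedMiddle c →
  let open LimitOrdinal κ in
  (Q : Pred Ord c) → ¬ (∀ α → Q α) → Σ Ord (λ α → (∀ β → β < α → Q β) × ¬ Q α)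
minimal-counterexample {c} κ em Q ¬all =
  em⇒dne em λ no-minimal → ¬all (All.wfRec wf c Q λ α below →
    em⇒dne em λ ¬Qα → no-minimal (α , (λ β β<α → below β<α) , ¬Qα))
  where open LimitOrdinal κ

module ModelLemmas {c : Level} {κ : LimitOrdinal c} (M : Model c κ) where
  open Model M
  open IsPartialOrder isPO public using (antisym) renaming (refl to ≤-refl; trans to ≤-trans)
  open IsStrictTotalOrder isSTO public using (compare)

  ⊑α-refl : ∀ {α x} → x ⊑[ α ] x
  ⊑α-refl {α} = IsPreorder.refl (⊑-preorder α)

  ⊑α-trans : ∀ {α x y z} → x ⊑[ α ] y → y ⊑[ α ] z → x ⊑[ α ] z
  ⊑α-trans {α} = IsPreorder.trans (⊑-preorder α)

  =α-refl : ∀ {α x} → x =[ α ] x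
  =α-refl = ⊑α-refl , ⊑α-refl

  =α-sym : ∀ {α x y} → x =[ α ] y → y =[ α ] x
  =α-sym (p , q) = q , p

  =α-trans : ∀ {α x y z} → x =[ α ] y → y =[ α ] z → x =[ α ] z
  =α-trans (p , q) (p′ , q′) = ⊑α-trans p p′ , ⊑α-trans q′ q

  =α-lower : ∀ {α β x y} → β < α → x =[ α ] y → x =[ β ] y
  =α-lower β<α (p , _) = A1 β<α p

  _=[<_]_ : L → Ord → L → Set c
  x =[< α ] y = ∀ β → β < α → x =[ β ] y

  =<-sym : ∀ {α x y} → x =[< α ] y → y =[< α ] x
  =<-sym p β β<α = =α-sym (p β β<α)

  =<-trans : ∀ {α x y z} → x =[< α ] y → y =[< α ] z → x =[< α ] z
  =<-trans p q β β<α = =α-trans (p β β<α) (q β β<α)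

  ∣-agrees : ∀ x α → x =[ α ] (x ∣ α)
  ∣-agrees x α = proj₁ (proj₂ (A3 x α))

  ∣-least : ∀ {x α z} → x ⊑[ α ] z → (x ∣ α) ≤ z
  ∣-least {x} {α} {z} = proj₂ (proj₂ (A3 x α)) z

  ∣-mono : ∀ {x y α} → x ⊑[ α ] y → (x ∣ α) ≤ (y ∣ α)
  ∣-mono {y = y} {α} p = ∣-least (⊑α-trans p (proj₁ (∣-agrees y α)))

  ∣-below : ∀ {x y α} → x =[< α ] y → (x ∣ α) =[< α ] y
  ∣-below {x} {α = α} p = =<-trans (λ β β<α → =α-lower β<α (=α-sym (∣-agrees x α))) p

  ⋁-cong : ∀ {I : Set c} (x y : I → L) → (∀ i → x i ≡ y i) → ⋁ x ≡ ⋁ y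
  ⋁-cong x y x≡y = antisym
    (⋁-least x (⋁ y) λ i → subst (_≤ ⋁ y) (sym (x≡y i)) (⋁-ub y i))
    (⋁-least y (⋁ x) λ i → subst (_≤ ⋁ x) (x≡y i) (⋁-ub x i))

  ⊑-antisym : ∀ {x y} → x ⊑ y → y ⊑ x → x ≡ y
  ⊑-antisym (inj₁ x≡y) _ = x≡y
  ⊑-antisym (inj₂ _) (inj₁ y≡x) = sym y≡x
  ⊑-antisym (inj₂ (α , p , ¬q)) (inj₂ (β , q , ¬p)) with compare α β
  ... | tri< α<β _ _ = ⊥-elim (¬q (proj₁ (A1 α<β q)))
  ... | tri≈ _ refl _ = ⊥-elim (¬q q)
  ... | tri> _ _ β<α = ⊥-elim (¬p (proj₁ (A1 β<α p)))

  -- If x ⊑ y and both agree below α, then x ⊑α y: the level witnessing x ⊑ y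
  -- cannot lie below α, and above α it yields the claim by (A1).
  ⊑-at : ∀ {α x y} → x ⊑ y → x =[< α ] y → x ⊑[ α ] y
  ⊑-at (inj₁ refl) _ = ⊑α-refl
  ⊑-at {α} (inj₂ (γ , p , ¬q)) agree with compare γ α
  ... | tri< γ<α _ _ = ⊥-elim (¬q (proj₂ (agree γ γ<α)))
  ... | tri≈ _ refl _ = p
  ... | tri> _ _ α<γ = proj₁ (A1 α<γ p)

  first-disagreement : ExcludedMiddle c → ∀ x y →
    (x ≡ y) ⊎ Σ Ord (λ α → x =[< α ] y × ¬ (x =[ α ] y))
  first-disagreement em x y with em {∀ α → x =[ α ] y}
  ... | yes agree = inj₁ (A2 agree)
  ... | no disagree = inj₂ (minimal-counterexample κ em (λ α → x =[ α ] y) disagree)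

  -- To prove x ⊑ y it suffices to prove x ⊑α y at every level α below which
  -- x and y agree (it is then used at the first level of disagreement).
  ⊑-intro : ExcludedMiddle c → ∀ {x y} → (∀ α → x =[< α ] y → x ⊑[ α ] y) → x ⊑ y
  ⊑-intro em {x} {y} level with first-disagreement em x y
  ... | inj₁ x≡y = inj₁ x≡y
  ... | inj₂ (α , agree , differ) = inj₂ (α , p , λ q → differ (p , q))
    where
      p : x ⊑[ α ] y
      p = level α agree

-- This is used both to form the base
-- of each stage (Q = below α) and the final fixed point (Q = everything).
module Gluing {c : Level} {κ : LimitOrdinal c} (M : Model c κ) where
  open Model M
  open ModelLemmas M

  glue : Pred Ord c → (Ord → L) → L
  glue Q g = ⋁ {Σ Ord Q} λ i → g (proj₁ i) ∣ proj₁ i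

  Coherent : Pred Ord c → (Ord → L) → Set c
  Coherent Q g = ∀ {β γ} → Q β → Q γ → β < γ → g β =[ β ] g γ

  module _ {Q : Pred Ord c} {g : Ord → L} (coherent : Coherent Q g) where

    restrictions-increase : ∀ {β γ} → Q β → Q γ → β < γ → (g β ∣ β) ≤ (g γ ∣ γ)
    restrictions-increase qβ qγ β<γ =
      ∣-least (⊑α-trans (proj₁ (coherent qβ qγ β<γ)) (proj₁ (=α-lower β<γ (∣-agrees _ _))))

    glue-agrees : ∀ β → Q β → glue Q g =[ β ] g β
    glue-agrees β qβ = subst (_=[ β ] g β) (sym glue≡tail) tail-agrees
      where
        -- the indices from β on; their join is the whole glued element
        Tail : Set c
        Tail = Σ Ord λ γ → Q γ × ((β ≡ γ) ⊎ (β < γ))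

        tail : L
        tail = ⋁ {Tail} λ t → g (proj₁ t) ∣ proj₁ t

        from-β : Tail
        from-β = β , qβ , inj₁ refl

        tail-member : (t : Tail) → (g (proj₁ t) ∣ proj₁ t) =[ β ] g β
        tail-member (_ , _ , inj₁ refl) = =α-sym (∣-agrees (g β) β)
        tail-member (γ , qγ , inj₂ β<γ) =
          =α-trans (=α-lower β<γ (=α-sym (∣-agrees (g γ) γ))) (=α-sym (coherent qβ qγ β<γ))

        tail-agrees : tail =[ β ] g β
        tail-agrees = A4 from-β _ (g β) β tail-member

        -- indices below β are dominated by the restriction at β
        below-tail : (i : Σ Ord Q) → (g (proj₁ i) ∣ proj₁ i) ≤ tail
        below-tail (δ , qδ) with compare δ β
        ... | tri< δ<β _ _ = ≤-trans (restrictions-increase qδ qβ δ<β) (⋁-ub _ from-β)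
        ... | tri≈ _ refl _ = ⋁-ub _ (δ , qδ , inj₁ refl)
        ... | tri> _ _ β<δ = ⋁-ub _ (δ , qδ , inj₂ β<δ)

        glue≡tail : glue Q g ≡ tail
        glue≡tail = antisym (⋁-least _ tail below-tail)
                            (⋁-least _ (glue Q g) λ t → ⋁-ub _ (proj₁ t , proj₁ (proj₂ t)))

module KnasterTarski {c : Level} {κ : LimitOrdinal c} (M : Model c κ) where
  open Model M
  open ModelLemmas M

  LowerBound : Pred L c → (L → L) → Pred L c
  LowerBound D h v = D v × (∀ w → D w → h w ≤ w → v ≤ w)

  μ : Pred L c → (L → L) → L
  μ D h = ⋁ {Σ L (LowerBound D h)} proj₁

  module LeastPreFixedPoint (D : Pred L c) (h : L → L)
           (D-⋁ : ∀ {I : Set c} → I → (x : I → L) → (∀ i → D (x i)) → D (⋁ x))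
           (⊥D : L) (⊥D-in : D ⊥D) (⊥D-least : ∀ w → D w → ⊥D ≤ w)
           (h-D : ∀ {w} → D w → D (h w))
           (h-mono : ∀ {w w′} → D w → D w′ → w ≤ w′ → h w ≤ h w′) where

    μ-in : D (μ D h)
    μ-in = D-⋁ (⊥D , ⊥D-in , λ w w-in _ → ⊥D-least w w-in) proj₁ (λ i → proj₁ (proj₂ i))

    μ-least : ∀ w → D w → h w ≤ w → μ D h ≤ w
    μ-least w w-in hw≤w = ⋁-least proj₁ w λ i → proj₂ (proj₂ i) w w-in hw≤w

    μ-fixed : h (μ D h) ≡ μ D h
    μ-fixed = antisym hμ≤μ (μ-least (h (μ D h)) (h-D μ-in) (h-mono (h-D μ-in) μ-in hμ≤μ))
      where
        -- h μ is itself a lower bound of the pre-fixed points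
        hμ≤μ : h (μ D h) ≤ μ D h
        hμ≤μ = ⋁-ub proj₁ (h (μ D h) , h-D μ-in ,
                 λ w w-in hw≤w → ≤-trans (h-mono μ-in w-in (μ-least w w-in hw≤w)) hw≤w)

module Construction {c : Level} {κ : LimitOrdinal c} (M : Model c κ)
  (f : Model.L M → Model.L M) (mono : ∀ α → Model._-Monotone_ M α f)
  (X : Pred (Model.L M) c) (post : ∀ x → X x → Model._≤_ M x (f x)) where
  open Model M
  open ModelLemmas M
  open Gluing M
  open KnasterTarski M

  f-=α : ∀ {α x y} → x =[ α ] y → f x =[ α ] f y
  f-=α {α} (p , q) = mono α p , mono α q

  f-=< : ∀ {α x y} → x =[< α ] y → f x =[< α ] f y
  f-=< p β β<α = f-=α (p β β<α)

  module Stage (α : Ord) (ℓ : L) where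
    Slice : Pred L c
    Slice w = w =[< α ] ℓ

    XSlice : Set c
    XSlice = Σ L λ x → X x × Slice x

    step-family : L → ⊤ {c} ⊎ XSlice → L
    step-family w (inj₁ _) = f w ∣ α
    step-family w (inj₂ (x , _)) = x ∣ α

    step : L → L
    step w = ⋁ (step-family w)

    stage : L
    stage = μ Slice step

    module Properties (ℓ-least : ∀ w → Slice w → ℓ ≤ w) (f-ℓ : f ℓ =[< α ] ℓ) where
      Slice-⋁ : ∀ {I : Set c} → I → (x : I → L) → (∀ i → Slice (x i)) → Slice (⋁ x)
      Slice-⋁ i x x-in β β<α = A4 i x ℓ β λ j → x-in j β β<α

      f-Slice : ∀ {w} → Slice w → Slice (f w)
      f-Slice w-in = =<-trans (f-=< w-in) f-ℓ

      Slice-⊑α : ∀ {w w′} → Slice w → Slice w′ → w ≤ w′ → w ⊑[ α ] w′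
      Slice-⊑α w-in w′-in w≤w′ = A6 α w≤w′ (=<-trans w-in (=<-sym w′-in))

      step-Slice : ∀ {w} → Slice w → Slice (step w)
      step-Slice {w} w-in = Slice-⋁ (inj₁ tt) (step-family w) member
        where
          member : ∀ i → Slice (step-family w i)
          member (inj₁ _) = ∣-below (f-Slice w-in)
          member (inj₂ (_ , _ , x-in)) = ∣-below x-in

      step-mono : ∀ {w w′} → Slice w → Slice w′ → w ≤ w′ → step w ≤ step w′
      step-mono {w} {w′} w-in w′-in w≤w′ = ⋁-least (step-family w) (step w′) member
        where
          member : ∀ i → step-family w i ≤ step w′
          member (inj₁ t) = ≤-trans (∣-mono (mono α (Slice-⊑α w-in w′-in w≤w′)))
                                    (⋁-ub (step-family w′) (inj₁ t))
          member (inj₂ s) = ⋁-ub (step-family w′) (inj₂ s)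

      open LeastPreFixedPoint Slice step Slice-⋁ ℓ (λ _ _ → =α-refl) ℓ-least step-Slice step-mono

      stage-in : Slice stage
      stage-in = μ-in

      X-below-stage : ∀ x → X x → Slice x → x ⊑[ α ] stage
      X-below-stage x x∈X x-in =
        ⊑α-trans (proj₁ (∣-agrees x α)) (Slice-⊑α (∣-below x-in) μ-in x∣α≤stage)
        where
          x∣α≤stage : (x ∣ α) ≤ stage
          x∣α≤stage = subst ((x ∣ α) ≤_) μ-fixed (⋁-ub (step-family stage) (inj₂ (x , x∈X , x-in)))

      -- the stage coincides with (f stage)|α, hence is an α-fixed point of f
      stage-fixed : f stage =[ α ] stage
      stage-fixed = subst (f stage =[ α ]_) (sym stage≡f-stage∣α) (∣-agrees (f stage) α)
        where
          member : ∀ i → step-family stage i ≤ (f stage ∣ α)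
          member (inj₁ _) = ≤-refl
          member (inj₂ (x , x∈X , x-in)) = ∣-mono (⊑α-trans
            (Slice-⊑α x-in (f-Slice x-in) (post x x∈X)) (mono α (X-below-stage x x∈X x-in)))

          stage≡f-stage∣α : stage ≡ f stage ∣ α
          stage≡f-stage∣α = antisym
            (subst (_≤ (f stage ∣ α)) μ-fixed (⋁-least (step-family stage) _ member))
            (subst ((f stage ∣ α) ≤_) μ-fixed (⋁-ub (step-family stage) (inj₁ tt)))

      -- any element of the slice that is α-above f of itself and above the
      -- members of X in the slice is α-above the stage, since its restriction
      -- to α is a pre-fixed point of the step
      stage-least : ∀ z → Slice z → f z ⊑[ α ] z → (∀ x → X x → Slice x → x ⊑[ α ] z) →
                    stage ⊑[ α ] z
      stage-least z z-in fz⊑z X⊑z = ⊑α-trans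
        (Slice-⊑α μ-in (∣-below z-in) (μ-least (z ∣ α) (∣-below z-in) (⋁-least _ _ member)))
        (proj₂ (∣-agrees z α))
        where
          member : ∀ i → step-family (z ∣ α) i ≤ (z ∣ α)
          member (inj₁ _) = ∣-mono (⊑α-trans (mono α (proj₂ (∣-agrees z α))) fz⊑z)
          member (inj₂ (x , x∈X , x-in)) = ∣-mono (X⊑z x x∈X x-in)

  next : (α : Ord) → WfRec _<_ (λ _ → L) α → L
  next α earlier = Stage.stage α (⋁ {Σ Ord (_< α)} λ i → earlier (proj₂ i) ∣ proj₁ i)

  Z : Ord → L
  Z = All.wfRec wf c (λ _ → L) next

  base : Ord → L
  base α = glue (_< α) Z

  -- the recursion equation, independent of accessibility proofs
  Z-unfold : ∀ {α} → Z α ≡ Stage.stage α (base α)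
  Z-unfold = FixPoint.unfold-wfRec wf (λ _ → L) next next-ext
    where
      next-ext : (α : Ord) {IH IH′ : WfRec _<_ (λ _ → L) α} →
                 (∀ {β} (β<α : β < α) → IH β<α ≡ IH′ β<α) → next α IH ≡ next α IH′
      next-ext α IH≡IH′ =
        cong (Stage.stage α) (⋁-cong _ _ λ i → cong (_∣ proj₁ i) (IH≡IH′ (proj₂ i)))

  Invariant : Pred Ord c
  Invariant α = (∀ β → β < α → Z β =[ β ] Z α) × (f (Z α) =[ α ] Z α)

  module StageGivenInvariant (α : Ord) (ih : ∀ {β} → β < α → Invariant β) where
    base-agrees : ∀ β → β < α → base α =[ β ] Z β
    base-agrees = glue-agrees λ _ γ<α β<γ → proj₁ (ih γ<α) _ β<γ

    base-least : ∀ w → Stage.Slice α (base α) w → base α ≤ w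
    base-least w w-in = ⋁-least _ w λ i →
      ∣-least (⊑α-trans (proj₂ (base-agrees (proj₁ i) (proj₂ i))) (proj₂ (w-in (proj₁ i) (proj₂ i))))

    f-base : f (base α) =[< α ] base α
    f-base β β<α = =α-trans (f-=α (base-agrees β β<α))
                            (=α-trans (proj₂ (ih β<α)) (=α-sym (base-agrees β β<α)))

    open Stage α (base α) public
    open Properties base-least f-base public

  invariant : ∀ α → Invariant α
  invariant = All.wfRec wf c Invariant λ α ih → let open StageGivenInvariant α ih in
    (λ β β<α → subst (Z β =[ β ]_) (sym Z-unfold)
                     (=α-sym (=α-trans (stage-in β β<α) (base-agrees β β<α))))
    , subst (λ t → f t =[ α ] t) (sym Z-unfold) stage-fixed

  y : L
  y = glue (λ _ → ⊤) Z

  y-agrees : ∀ α → y =[ α ] Z α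
  y-agrees α = glue-agrees (λ _ _ β<γ → proj₁ (invariant _) _ β<γ) α tt

  y-fixed : f y ≡ y
  y-fixed = A2 λ α → =α-trans (f-=α (y-agrees α)) (=α-trans (proj₂ (invariant α)) (=α-sym (y-agrees α)))

  module AtLevel (α : Ord) where
    open StageGivenInvariant α (λ _ → invariant _)

    base-y : base α =[< α ] y
    base-y β β<α = =α-trans (base-agrees β β<α) (=α-sym (y-agrees β))

    slice-y : ∀ {w} → w =[< α ] y → Slice w
    slice-y w-y = =<-trans w-y (=<-sym base-y)

    X-below-y-at : ∀ x → X x → x =[< α ] y → x ⊑[ α ] y
    X-below-y-at x x∈X x-y = ⊑α-trans
      (subst (x ⊑[ α ]_) (sym Z-unfold) (X-below-stage x x∈X (slice-y x-y)))
      (proj₂ (y-agrees α))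

    y-least-at : ∀ z → (∀ x → X x → x ⊑ z) → f z ⊑ z → y =[< α ] z → y ⊑[ α ] z
    y-least-at z X⊑z fz⊑z y-z = ⊑α-trans (proj₁ (y-agrees α))
      (subst (_⊑[ α ] z) (sym Z-unfold) (stage-least z (slice-y z-y) (⊑-at fz⊑z fz-z) X⊑z-at))
      where
        z-y : z =[< α ] y
        z-y = =<-sym y-z

        fz-z : f z =[< α ] z
        fz-z = =<-trans (subst (f z =[< α ]_) y-fixed (f-=< z-y)) y-z

        X⊑z-at : ∀ x → X x → Slice x → x ⊑[ α ] z
        X⊑z-at x x∈X x-in = ⊑-at (X⊑z x x∈X) (=<-trans x-in (=<-trans base-y y-z))

  IsLeastFixedAbove : Pred L c
  IsLeastFixedAbove v = (∀ x → X x → x ⊑ v)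
                      × (f v ≡ v)
                      × (∀ z → (∀ x → X x → x ⊑ z) → f z ⊑ z → v ⊑ z)

  least-fixed-above-unique : ∀ {v w} → IsLeastFixedAbove v → IsLeastFixedAbove w → v ≡ w
  least-fixed-above-unique (X⊑v , fv≡v , v-least) (X⊑w , fw≡w , w-least) =
    ⊑-antisym (v-least _ X⊑w (inj₁ fw≡w)) (w-least _ X⊑v (inj₁ fv≡v))

  X-below-y : ExcludedMiddle c → ∀ x → X x → x ⊑ y
  X-below-y em x x∈X = ⊑-intro em λ α → AtLevel.X-below-y-at α x x∈X

  y-least : ExcludedMiddle c → ∀ z → (∀ x → X x → x ⊑ z) → f z ⊑ z → y ⊑ z
  y-least em z X⊑z fz⊑z = ⊑-intro em λ α → AtLevel.y-least-at α z X⊑z fz⊑z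

theorem3 : {c : Level} → ExcludedMiddle c →
    (κ : LimitOrdinal c) (M : Model c κ) →
    let open Model M in
    (f : L → L) → (∀ α → α -Monotone f) →
    (X : Pred L c) → (∀ x → X x → x ≤ f x) →
    ∃! _≡_ (λ y → (∀ x → X x → x ⊑ y)
    × (f y ≡ y)
    × (∀ z → (∀ x → X x → x ⊑ z) → f z ⊑ z → y ⊑ z))
theorem3 em κ M f mono X post = y , y-least-fixed , least-fixed-above-unique y-least-fixed
  where
    open Construction M f mono X post

    y-least-fixed : IsLeastFixedAbove y
    y-least-fixed = X-below-y em , y-fixed , y-least em
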